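{- Let $n \geq 2$ and $T \in \mathcal{Y}_n$. Then the set of $1$-minors of $T - n$ equals $\{\, S - (n-1) : S \text{ a } 1\text{ -minor of } T \,\}$; that is, the $1$-minors of $T-n$ are obtained by deleting the entry $n-1$ from each of the $1$-minors of $T$.
   Context: A partition $\lambda$ of $n$ is a non-increasing finite sequence $(\lambda_1,\ldots,\lambda_m)$ of positive integers summing to $n$; its Young diagram is a left-aligned array of cells with $\lambda_h$ cells in row $h$ (rows counted from the top). A standard Young tableau of shape $\lambda$ is a filling of the Young diagram of $\lambda$ with $1,\ldots,n$, each exactly once, increasing left to right along rows and top to bottom down columns; $\mathcal{Y}_n$ denotes the set of standard Young tableaux with $n$ entries. For $T \in \mathcal{Y}_n$ and $m \in \{1,\ldots,n\}$, the tableau $T - m \in \mathcal{Y}_{n-1}$ is obtained as follows: remove the cell containing $m$, leaving a space; repeatedly, let $R$ be the cell immediately right of the space and $B$ the cell immediately below it (if they exist); if $R$ exists and ($B$ does not exist or the entry of $R$ is smaller than that of $B$), slide $R$ into the space; otherwise, if $B$ exists, slide $B$ into the space; if neither exists, stop (jeu de taquin). Finally renumber every entry $p > m$ as $p-1$. The set of $1$-minors of $T$ is $\{T - m : 1 \leq m \leq n\}$. -}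

module Defs where

open import Data.Nat using (ℕ; zero; suc; _+_; _∸_; _≤_; _<_; _<ᵇ_; _≡ᵇ_)
open import Data.Bool using (Bool; true; false; if_then_else_)
open import Data.List using (List; []; _∷_; length; map; concat; upTo)
open import Data.Nat.ListAction using (sum)
open import Data.List.Relation.Unary.All using (All)
open import Data.List.Relation.Unary.Linked using (Linked)
open import Data.List.Relation.Binary.Permutation.Propositional using (_↭_)
open import Data.Maybe using (Maybe; just; nothing)
open import Data.Product using (_×_; _,_)
open import Relation.Binary.PropositionalEquality using (_≡_)

-- A tableau is a list of rows (top row first), each row a list of entries
-- (left to right).
Tableau : Set
Tableau = List (List ℕ)

rowGet : List ℕ → ℕ → Maybe ℕ
rowGet []       _       = nothing
rowGet (x ∷ xs) zero    = just x
rowGet (x ∷ xs) (suc j) = rowGet xs j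

-- entry at (row i, column j), 0-based
get : Tableau → ℕ → ℕ → Maybe ℕ
get []       _       j = nothing
get (r ∷ rs) zero    j = rowGet r j
get (r ∷ rs) (suc i) j = get rs i j

rowSet : List ℕ → ℕ → ℕ → List ℕ
rowSet []       _       v = []
rowSet (x ∷ xs) zero    v = v ∷ xs
rowSet (x ∷ xs) (suc j) v = x ∷ rowSet xs j v

set : Tableau → ℕ → ℕ → ℕ → Tableau
set []       _       j v = []
set (r ∷ rs) zero    j v = rowSet r j v ∷ rs
set (r ∷ rs) (suc i) j v = r ∷ set rs i j v

ColInc : List ℕ → List ℕ → Set
ColInc r s = ∀ j x y → rowGet r j ≡ just x → rowGet s j ≡ just y → x < y

Shorter : List ℕ → List ℕ → Set
Shorter r s = length s ≤ length r

NonEmpty : List ℕ → Set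
NonEmpty r = 1 ≤ length r

record IsSYT (n : ℕ) (T : Tableau) : Set where
  field
    rowsNonEmpty : All NonEmpty T
    shape        : Linked Shorter T
    rowsInc      : All (Linked _<_) T
    colsInc      : Linked ColInc T
    entries      : concat T ↭ map suc (upTo n)

-- remove the cell at (i, j): the final position of the space. It is the
-- last cell of its row; a row that becomes empty is dropped.
dropLast : List ℕ → List ℕ
dropLast []           = []
dropLast (x ∷ [])     = []
dropLast (x ∷ y ∷ xs) = x ∷ dropLast (y ∷ xs)

removeEnd : Tableau → ℕ → Tableau
removeEnd []       _       = []
removeEnd (r ∷ rs) zero    with dropLast r
... | []      = rs
... | r′@(_ ∷ _) = r′ ∷ rs
removeEnd (r ∷ rs) (suc i) = r ∷ removeEnd rs i

-- the space is at (i, j); slide cells into it as described. The fuel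
-- bounds the number of slides (each slide moves the space right or down,
-- so the number of cells of T is always enough fuel).
slide : ℕ → Tableau → ℕ → ℕ → Tableau
slide zero     T i j = removeEnd T i
slide (suc f)  T i j with get T i (suc j) | get T (suc i) j
... | just r  | nothing = slide f (set T i j r) i (suc j)
... | nothing | just b  = slide f (set T i j b) (suc i) j
... | nothing | nothing = removeEnd T i
... | just r  | just b  = if r <ᵇ b then slide f (set T i j r) i (suc j)
                                    else slide f (set T i j b) (suc i) j

rowFind : ℕ → List ℕ → Maybe ℕ
rowFind m []       = nothing
rowFind m (x ∷ xs) = if x ≡ᵇ m then just zero else Data.Maybe.map suc (rowFind m xs)

find : ℕ → Tableau → Maybe (ℕ × ℕ)
find m []       = nothing
find m (r ∷ rs) with rowFind m r
... | just j  = just (zero , j)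
... | nothing = Data.Maybe.map (λ { (i , j) → (suc i , j) }) (find m rs)

size : Tableau → ℕ
size T = sum (map length T)

renumber : ℕ → Tableau → Tableau
renumber m = map (map (λ p → if m <ᵇ p then p ∸ 1 else p))

-- T - m  (if m does not occur in T, T is returned unchanged; this never
-- happens in the theorem, where 1 ≤ m ≤ n and T has entries 1..n)
_−_ : Tableau → ℕ → Tableau
T − m with find m T
... | nothing      = T
... | just (i , j) = renumber m (slide (size T) T i j)

infixl 6 _−_

module Submission where

-- The entry n of T sits in a corner c, so T − n just deletes c; this settles m = n, and it
-- remains to show (T − n) − m = (T − m) − (n − 1) for m < n. Run the slides from the cell of m
-- in T and in T − n side by side. Since n exceeds every other entry, it is never preferred to
-- another neighbour of the space, so both slides make the same moves until the space would
-- move into c; then the slide in T moves n into the space and stops in c, while the slide in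
-- T − n stops where the space is. Either way the slide in T ends with n in a corner whose
-- deletion gives the slide in T − n; renumbering turns n into n − 1, the maximum of T − m,
-- and (T − m) − (n − 1) deletes exactly that corner.

open import Defs
open import Data.Bool using (T; true; false; if_then_else_)
open import Data.Empty using (⊥; ⊥-elim)
open import Data.List using (List; []; _∷_; length; map; concat; _++_)
open import Data.List.Membership.Propositional using (_∈_; _∉_)
open import Data.List.Membership.Propositional.Properties
  using (∈-++⁺ˡ; ∈-++⁺ʳ; ∈-++⁻; ∈-map⁺; ∈-map⁻; ∈-upTo⁺; ∈-upTo⁻)
open import Data.List.Relation.Binary.Permutation.Propositional using (↭-sym; ↭⇒↭ₛ)
open import Data.List.Relation.Binary.Permutation.Propositional.Properties using (∈-resp-↭)
open import Data.List.Relation.Unary.All using (All; []; _∷_)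
import Data.List.Relation.Unary.All as All
import Data.List.Relation.Unary.All.Properties as All
open import Data.List.Relation.Unary.AllPairs using ([]; _∷_)
open import Data.List.Relation.Unary.Any using (here; there)
open import Data.List.Relation.Unary.Linked using (Linked; _∷_)
open import Data.List.Relation.Unary.Unique.Propositional using (Unique)
import Data.List.Relation.Unary.Unique.Propositional.Properties as Unique
open import Data.Maybe using (Maybe; just; nothing)
import Data.Maybe as Maybe
open import Data.Maybe.Properties using (just-injective; map-nothing)
open import Data.Nat using (ℕ; zero; suc; _+_; _∸_; _≤_; _<_; _<ᵇ_; _≡ᵇ_; z≤n; s≤s)
open import Data.Nat.Properties
open import Data.Product using (Σ; Σ-syntax; _×_; _,_; proj₁; proj₂)
open import Data.Product.Properties using (≡-dec)
open import Data.Sum using (_⊎_; inj₁; inj₂)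
open import Function using (_∘_; case_of_)
open import Function.Bundles using (_⇔_; mk⇔)
open import Relation.Binary.Definitions using (DecidableEquality)
open import Relation.Binary.PropositionalEquality
open import Relation.Nullary using (yes; no; contradiction)
open import Relation.Nullary.Decidable using (toSum)
open import Data.List.Relation.Binary.Permutation.Setoid.Properties (setoid ℕ) using (Unique-resp-↭)
open ≡-Reasoning

-- Positions and grids

Pos : Set
Pos = ℕ × ℕ

_≟ₚ_ : DecidableEquality Pos
_≟ₚ_ = ≡-dec _≟_ _≟_

right below : Pos → Pos
right (i , j) = i , suc j
below (i , j) = suc i , j

Neighbour : Pos → Pos → Set
Neighbour s t = t ≡ right s ⊎ t ≡ below s

neighbour≢ : ∀ {s t} → Neighbour s t → t ≢ s
neighbour≢ (inj₁ refl) = 1+n≢n ∘ cong proj₂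
neighbour≢ (inj₂ refl) = 1+n≢n ∘ cong proj₁

below≢right : ∀ s → below s ≢ right s
below≢right s = 1+n≢n ∘ cong proj₁

right≢below : ∀ s → right s ≢ below s
right≢below s = below≢right s ∘ sym

Grid : Set
Grid = Pos → Maybe ℕ

_[_]≔_ : Grid → Pos → Maybe ℕ → Grid
(g [ x ]≔ v) y with y ≟ₚ x
... | yes _ = v
... | no  _ = g y

≔-same : ∀ g x v → (g [ x ]≔ v) x ≡ v
≔-same g x v with x ≟ₚ x
... | yes _   = refl
... | no  x≢x = contradiction refl x≢x

≔-other : ∀ g {x} v {y} → y ≢ x → (g [ x ]≔ v) y ≡ g y
≔-other g {x} v {y} y≢x with y ≟ₚ x
... | yes y≡x = contradiction y≡x y≢x
... | no  _   = refl

≔-hit : ∀ g {x} v {y} → y ≡ x → (g [ x ]≔ v) y ≡ v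
≔-hit g {x} v refl = ≔-same g x v

≔-cong : ∀ {g h} x v → g ≗ h → g [ x ]≔ v ≗ h [ x ]≔ v
≔-cong {g} {h} x v g≗h y with toSum (y ≟ₚ x)
... | inj₁ y≡x = trans (≔-hit g v y≡x) (sym (≔-hit h v y≡x))
... | inj₂ y≢x = trans (≔-other g v y≢x) (trans (g≗h y) (sym (≔-other h v y≢x)))

≔-comm : ∀ g {x x′} v v′ → x ≢ x′ → (g [ x ]≔ v) [ x′ ]≔ v′ ≗ (g [ x′ ]≔ v′) [ x ]≔ v
≔-comm g {x} {x′} v v′ x≢x′ y with toSum (y ≟ₚ x) | toSum (y ≟ₚ x′)
... | inj₁ y≡x | inj₁ y≡x′ = contradiction (trans (sym y≡x) y≡x′) x≢x′
... | inj₁ y≡x | inj₂ y≢x′ = trans (≔-other _ v′ y≢x′) (trans (≔-hit g v y≡x) (sym (≔-hit _ v y≡x)))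
... | inj₂ y≢x | inj₁ y≡x′ = trans (≔-hit _ v′ y≡x′) (sym (trans (≔-other _ v y≢x) (≔-hit g v′ y≡x′)))
... | inj₂ y≢x | inj₂ y≢x′ =
  trans (≔-other _ v′ y≢x′) (trans (≔-other g v y≢x) (sym (trans (≔-other _ v y≢x) (≔-other g v′ y≢x′))))

≔-idem : ∀ g x v v′ → (g [ x ]≔ v) [ x ]≔ v′ ≗ g [ x ]≔ v′
≔-idem g x v v′ y with toSum (y ≟ₚ x)
... | inj₁ y≡x = trans (≔-hit _ v′ y≡x) (sym (≔-hit g v′ y≡x))
... | inj₂ y≢x = trans (≔-other _ v′ y≢x) (trans (≔-other g v y≢x) (sym (≔-other g v′ y≢x)))

≔-just : ∀ g x v {y u} → (g [ x ]≔ v) y ≡ just u → (y ≡ x × v ≡ just u) ⊎ (y ≢ x × g y ≡ just u)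
≔-just g x v {y} gy with toSum (y ≟ₚ x)
... | inj₁ y≡x = inj₁ (y≡x , trans (sym (≔-hit g v y≡x)) gy)
... | inj₂ y≢x = inj₂ (y≢x , trans (sym (≔-other g v y≢x)) gy)

record Corner (g : Grid) (c : Pos) : Set where
  constructor _,_
  field
    rightEmpty : g (right c) ≡ nothing
    belowEmpty : g (below c) ≡ nothing

Corner-resp : ∀ {g h c} → g ≗ h → Corner h c → Corner g c
Corner-resp g≗h (r , b) = trans (g≗h _) r , trans (g≗h _) b

-- An occupied cell is not a neighbour of the corner, so writing into it keeps the corner.
Corner-≔ : ∀ {g c x w} v → g x ≡ just w → Corner g c → Corner (g [ x ]≔ v) c
Corner-≔ {g} {c} {x} v gx (r , b) = keep r , keep b
  where
  keep : ∀ {y} → g y ≡ nothing → (g [ x ]≔ v) y ≡ nothing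
  keep {y} gy with y ≟ₚ x
  ... | yes refl = contradiction (trans (sym gx) gy) λ ()
  ... | no  _    = gy

Corner-clear : ∀ {g c} x → Corner g c → Corner (g [ x ]≔ nothing) c
Corner-clear {g} x (r , b) = keep r , keep b
  where
  keep : ∀ {y} → g y ≡ nothing → (g [ x ]≔ nothing) y ≡ nothing
  keep {y} gy with y ≟ₚ x
  ... | yes _ = refl
  ... | no  _ = gy

-- Tableaux as grids

cells : Tableau → Grid
cells X (i , j) = get X i j

update : Tableau → Pos → ℕ → Tableau
update X (i , j) = set X i j

-- Only the row index matters: the removed cell is the last one of its row.
removeAt : Tableau → Pos → Tableau
removeAt X (i , _) = removeEnd X i

record Removable (X : Tableau) (c : Pos) : Set where
  field
    nonEmpty : All NonEmpty X
    entry    : ℕ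
    occupied : cells X c ≡ just entry
    corner   : Corner (cells X) c

rowSet-length : ∀ r j v → length (rowSet r j v) ≡ length r
rowSet-length []      _       _ = refl
rowSet-length (x ∷ r) zero    _ = refl
rowSet-length (x ∷ r) (suc j) v = cong suc (rowSet-length r j v)

rowGet-rowSet-same : ∀ r j v {w} → rowGet r j ≡ just w → rowGet (rowSet r j v) j ≡ just v
rowGet-rowSet-same (x ∷ r) zero    v _  = refl
rowGet-rowSet-same (x ∷ r) (suc j) v rj = rowGet-rowSet-same r j v rj

rowGet-rowSet-other : ∀ r j v {q} → q ≢ j → rowGet (rowSet r j v) q ≡ rowGet r q
rowGet-rowSet-other []      j       v         _   = refl
rowGet-rowSet-other (x ∷ r) zero    v {zero}  q≢j = contradiction refl q≢j
rowGet-rowSet-other (x ∷ r) zero    v {suc q} _   = refl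
rowGet-rowSet-other (x ∷ r) (suc j) v {zero}  _   = refl
rowGet-rowSet-other (x ∷ r) (suc j) v {suc q} q≢j = rowGet-rowSet-other r j v (q≢j ∘ cong suc)

get-set-same : ∀ X i j v {w} → get X i j ≡ just w → get (set X i j v) i j ≡ just v
get-set-same (r ∷ X) zero    j v rj = rowGet-rowSet-same r j v rj
get-set-same (r ∷ X) (suc i) j v Xj = get-set-same X i j v Xj

get-set-other : ∀ X i j v {p q} → (p , q) ≢ (i , j) → get (set X i j v) p q ≡ get X p q
get-set-other []      i       j v              _  = refl
get-set-other (r ∷ X) zero    j v {zero}  {q}  ne = rowGet-rowSet-other r j v (ne ∘ cong (zero ,_))
get-set-other (r ∷ X) zero    j v {suc p}      _  = refl
get-set-other (r ∷ X) (suc i) j v {zero}       _  = refl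
get-set-other (r ∷ X) (suc i) j v {suc p}      ne = get-set-other X i j v (ne ∘ cong below)

cells-update : ∀ X x v {w} → cells X x ≡ just w → cells (update X x v) ≗ cells X [ x ]≔ just v
cells-update X x@(i , j) v Xx y with toSum (y ≟ₚ x)
... | inj₁ refl = trans (get-set-same X i j v Xx) (sym (≔-same (cells X) x (just v)))
... | inj₂ y≢x  = trans (get-set-other X i j v y≢x) (sym (≔-other (cells X) (just v) y≢x))

rowGet-dropLast : ∀ r b {v} → rowGet r b ≡ just v → rowGet r (suc b) ≡ nothing →
  rowGet (dropLast r) b ≡ nothing × (∀ {q} → q ≢ b → rowGet (dropLast r) q ≡ rowGet r q)
rowGet-dropLast (x ∷ [])    zero    _  _   = refl , λ { {zero} 0≢0 → contradiction refl 0≢0 ; {suc q} _ → refl }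
rowGet-dropLast (x ∷ y ∷ r) (suc b) rb rb′ with rowGet-dropLast (y ∷ r) b rb rb′
... | gone , kept = gone , λ { {zero} _ → refl ; {suc q} q≢b → kept (q≢b ∘ cong suc) }

get-removeEnd : ∀ X i j {v} → All NonEmpty X → get X i j ≡ just v →
  get X i (suc j) ≡ nothing → get X (suc i) j ≡ nothing →
  get (removeEnd X i) i j ≡ nothing × (∀ {p q} → (p , q) ≢ (i , j) → get (removeEnd X i) p q ≡ get X p q)
get-removeEnd ((x ∷ []) ∷ [])            zero zero _ _ _ _ =
  refl , λ { {zero} {zero} ne → contradiction refl ne ; {zero} {suc q} _ → refl ; {suc p} _ → refl }
get-removeEnd ((x ∷ []) ∷ ([] ∷ X))      zero zero (_ ∷ () ∷ _) _ _ _
get-removeEnd ((x ∷ []) ∷ ((y ∷ r) ∷ X)) zero zero _ _ _ ()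
get-removeEnd ((x ∷ y ∷ r) ∷ X) zero j _ rj rj′ _ with rowGet-dropLast (x ∷ y ∷ r) j rj rj′
... | gone , kept = gone , λ { {zero} ne → kept (ne ∘ cong (zero ,_)) ; {suc p} _ → refl }
get-removeEnd (r ∷ X) (suc i) j (_ ∷ ne) Xj Xr Xb with get-removeEnd X i j ne Xj Xr Xb
... | gone , kept = gone , λ { {zero} _ → refl ; {suc p} ne′ → kept (ne′ ∘ cong below) }

cells-removeAt : ∀ {X c} → Removable X c → cells (removeAt X c) ≗ cells X [ c ]≔ nothing
cells-removeAt {X} {c@(i , j)} ρ y with get-removeEnd X i j nonEmpty occupied rightEmpty belowEmpty | toSum (y ≟ₚ c)
  where open Removable ρ; open Corner corner
... | gone , _    | inj₁ refl = trans gone (sym (≔-same (cells X) c nothing))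
... | _    , kept | inj₂ y≢c  = trans (kept y≢c) (sym (≔-other (cells X) nothing y≢c))

update-nonEmpty : ∀ X x v → All NonEmpty X → All NonEmpty (update X x v)
update-nonEmpty X (i , j) v = go X i
  where
  go : ∀ X i → All NonEmpty X → All NonEmpty (set X i j v)
  go []      _       []        = []
  go (r ∷ X) zero    (r≠ ∷ ne) = subst (1 ≤_) (sym (rowSet-length r j v)) r≠ ∷ ne
  go (r ∷ X) (suc i) (r≠ ∷ ne) = r≠ ∷ go X i ne

removeAt-nonEmpty : ∀ X c → All NonEmpty X → All NonEmpty (removeAt X c)
removeAt-nonEmpty X (i , _) = go X i
  where
  go : ∀ X i → All NonEmpty X → All NonEmpty (removeEnd X i)
  go []                _       []        = []
  go ((x ∷ []) ∷ X)    zero    (_ ∷ ne)  = ne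
  go ((x ∷ y ∷ r) ∷ X) zero    (_ ∷ ne)  = s≤s z≤n ∷ ne
  go (r ∷ X)           (suc i) (r≠ ∷ ne) = r≠ ∷ go X i ne

size-removeAt : ∀ X c {v} → cells X c ≡ just v → size X ≡ suc (size (removeAt X c))
size-removeAt X (i , j) = go X i
  where
  dropLast-length : ∀ y r → length (dropLast (y ∷ r)) ≡ length r
  dropLast-length y []      = refl
  dropLast-length y (z ∷ r) = cong suc (dropLast-length z r)
  go : ∀ X i {v} → get X i j ≡ just v → size X ≡ suc (size (removeEnd X i))
  go ((x ∷ []) ∷ X)    zero    _  = refl
  go ((x ∷ y ∷ r) ∷ X) zero    _  = cong (λ k → suc (suc k) + size X) (sym (dropLast-length y r))
  go (r ∷ X)           (suc i) Xj = trans (cong (length r +_) (go X i Xj)) (+-suc (length r) _)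

-- Empty rows are invisible in the grid, hence the nonemptiness hypotheses.
cells-injective : ∀ {X Y} → All NonEmpty X → All NonEmpty Y → cells X ≗ cells Y → X ≡ Y
cells-injective {[]}          {[]}          _         _         _   = refl
cells-injective {[]}          {(y ∷ s) ∷ Y} _         _         X≗Y = contradiction (X≗Y (0 , 0)) λ ()
cells-injective {(x ∷ r) ∷ X} {[]}          _         _         X≗Y = contradiction (X≗Y (0 , 0)) λ ()
cells-injective {[] ∷ X}      {_}           (() ∷ _)  _         _
cells-injective {_}           {[] ∷ Y}      _         (() ∷ _)  _
cells-injective {r ∷ X}       {s ∷ Y}       (_ ∷ neX) (_ ∷ neY) X≗Y =
  cong₂ _∷_ (rows r s (λ q → X≗Y (0 , q))) (cells-injective neX neY (λ (p , q) → X≗Y (suc p , q)))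
  where
  rows : ∀ r s → (∀ q → rowGet r q ≡ rowGet s q) → r ≡ s
  rows []      []      _   = refl
  rows []      (y ∷ s) r≗s = contradiction (r≗s 0) λ ()
  rows (x ∷ r) []      r≗s = contradiction (r≗s 0) λ ()
  rows (x ∷ r) (y ∷ s) r≗s = cong₂ _∷_ (just-injective (r≗s 0)) (rows r s (r≗s ∘ suc))

update-same : ∀ X x v {w} → cells X x ≡ just w → cells (update X x v) x ≡ just v
update-same X x v Xx = trans (cells-update X x v Xx x) (≔-same (cells X) x (just v))

update-other : ∀ X x v {w y} → cells X x ≡ just w → y ≢ x → cells (update X x v) y ≡ cells X y
update-other X x v Xx y≢x = trans (cells-update X x v Xx _) (≔-other (cells X) (just v) y≢x)

update-just : ∀ X x v {w y u} → cells X x ≡ just w → cells (update X x v) y ≡ just u →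
  (y ≡ x × v ≡ u) ⊎ (y ≢ x × cells X y ≡ just u)
update-just X x v {y = y} Xx Uy with ≔-just (cells X) x (just v) (trans (sym (cells-update X x v Xx y)) Uy)
... | inj₁ (y≡x , refl) = inj₁ (y≡x , refl)
... | inj₂ found        = inj₂ found

update-corner : ∀ X x v {w c} → cells X x ≡ just w → Corner (cells X) c → Corner (cells (update X x v)) c
update-corner X x v Xx cc = Corner-resp (cells-update X x v Xx) (Corner-≔ (just v) Xx cc)

update-removable : ∀ {X c} x v {w} → cells X x ≡ just w → x ≢ c → Removable X c → Removable (update X x v) c
update-removable {X} x v Xx x≢c ρ = record
  { nonEmpty = update-nonEmpty X x v nonEmpty
  ; occupied = trans (update-other X x v Xx (x≢c ∘ sym)) occupied
  ; corner   = update-corner X x v Xx corner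
  }
  where open Removable ρ

removeAt-other : ∀ {X c} → Removable X c → ∀ {y} → y ≢ c → cells (removeAt X c) y ≡ cells X y
removeAt-other {X} ρ y≢c = trans (cells-removeAt ρ _) (≔-other (cells X) nothing y≢c)

removeAt-just : ∀ {X c} → Removable X c → ∀ {y u} → cells (removeAt X c) y ≡ just u → y ≢ c × cells X y ≡ just u
removeAt-just {X} {c} ρ {y} X′y with ≔-just (cells X) c nothing (trans (sym (cells-removeAt ρ y)) X′y)
... | inj₂ found = found

removeAt-corner : ∀ {X c s} → Removable X c → Corner (cells X) s → Corner (cells (removeAt X c)) s
removeAt-corner {c = c} ρ cs = Corner-resp (cells-removeAt ρ) (Corner-clear c cs)

removeAt-removable : ∀ {X c s} → Removable X c → Removable X s → s ≢ c → Removable (removeAt X c) s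
removeAt-removable {X} {c} {s} ρ ρ′ s≢c = record
  { nonEmpty = removeAt-nonEmpty X c (Removable.nonEmpty ρ)
  ; occupied = trans (removeAt-other ρ s≢c) (Removable.occupied ρ′)
  ; corner   = removeAt-corner ρ (Removable.corner ρ′)
  }

removeAt-comm : ∀ {X c s} → Removable X c → Removable X s → c ≢ s →
  removeAt (removeAt X c) s ≡ removeAt (removeAt X s) c
removeAt-comm {X} {c} {s} ρ ρ′ c≢s =
  cells-injective (removeAt-nonEmpty _ s (Removable.nonEmpty ρc)) (removeAt-nonEmpty _ c (Removable.nonEmpty ρs)) λ y → begin
  cells (removeAt (removeAt X c) s) y              ≡⟨ cells-removeAt ρc y ⟩
  (cells (removeAt X c) [ s ]≔ nothing) y          ≡⟨ ≔-cong s nothing (cells-removeAt ρ) y ⟩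
  ((cells X [ c ]≔ nothing) [ s ]≔ nothing) y      ≡⟨ ≔-comm (cells X) nothing nothing c≢s y ⟩
  ((cells X [ s ]≔ nothing) [ c ]≔ nothing) y      ≡⟨ ≔-cong c nothing (cells-removeAt ρ′) y ⟨
  (cells (removeAt X s) [ c ]≔ nothing) y          ≡⟨ cells-removeAt ρs y ⟨
  cells (removeAt (removeAt X s) c) y              ∎
  where
  ρc : Removable (removeAt X c) s
  ρc = removeAt-removable ρ ρ′ (c≢s ∘ sym)
  ρs : Removable (removeAt X s) c
  ρs = removeAt-removable ρ′ ρ c≢s

update-removeAt-comm : ∀ {X c} s u {w} → Removable X c → cells X s ≡ just w → s ≢ c →
  update (removeAt X c) s u ≡ removeAt (update X s u) c
update-removeAt-comm {X} {c} s u ρ Xs s≢c = cells-injective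
  (update-nonEmpty _ s u (removeAt-nonEmpty X c (Removable.nonEmpty ρ)))
  (removeAt-nonEmpty _ c (Removable.nonEmpty ρ′)) λ y → begin
  cells (update (removeAt X c) s u) y              ≡⟨ cells-update (removeAt X c) s u (trans (removeAt-other ρ s≢c) Xs) y ⟩
  (cells (removeAt X c) [ s ]≔ just u) y           ≡⟨ ≔-cong s (just u) (cells-removeAt ρ) y ⟩
  ((cells X [ c ]≔ nothing) [ s ]≔ just u) y       ≡⟨ ≔-comm (cells X) nothing (just u) (s≢c ∘ sym) y ⟩
  ((cells X [ s ]≔ just u) [ c ]≔ nothing) y       ≡⟨ ≔-cong c nothing (cells-update X s u Xs) y ⟨
  (cells (update X s u) [ c ]≔ nothing) y          ≡⟨ cells-removeAt ρ′ y ⟨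
  cells (removeAt (update X s u) c) y              ∎
  where
  ρ′ : Removable (update X s u) c
  ρ′ = update-removable s u Xs s≢c ρ

removeAt-update : ∀ {X s} u → Removable X s → removeAt (update X s u) s ≡ removeAt X s
removeAt-update {X} {s} u ρ = cells-injective
  (removeAt-nonEmpty _ s (Removable.nonEmpty ρ′)) (removeAt-nonEmpty X s (Removable.nonEmpty ρ)) λ y → begin
  cells (removeAt (update X s u) s) y              ≡⟨ cells-removeAt ρ′ y ⟩
  (cells (update X s u) [ s ]≔ nothing) y          ≡⟨ ≔-cong s nothing (cells-update X s u occupied) y ⟩
  ((cells X [ s ]≔ just u) [ s ]≔ nothing) y       ≡⟨ ≔-idem (cells X) s (just u) nothing y ⟩
  (cells X [ s ]≔ nothing) y                       ≡⟨ cells-removeAt ρ y ⟨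
  cells (removeAt X s) y                           ∎
  where
  open Removable ρ
  ρ′ : Removable (update X s u) s
  ρ′ = record
    { nonEmpty = update-nonEmpty X s u nonEmpty
    ; occupied = update-same X s u occupied
    ; corner   = update-corner X s u occupied corner
    }

-- One move of jeu de taquin

choose : Pos → Maybe ℕ → Maybe ℕ → Maybe Pos
choose s (just r) (just b) = if r <ᵇ b then just (right s) else just (below s)
choose s (just _) nothing  = just (right s)
choose s nothing  (just _) = just (below s)
choose s nothing  nothing  = nothing

next : Tableau → Pos → Maybe Pos
next X s = choose s (cells X (right s)) (cells X (below s))

slideAt : ℕ → Tableau → Pos → Tableau
slideAt f X (i , j) = slide f X i j

next-nothing : ∀ X s → next X s ≡ nothing → Corner (cells X) s
next-nothing X (i , j) ns with get X i (suc j) in Xr | get X (suc i) j in Xb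
next-nothing X (i , j) ns | nothing | nothing = Xr , Xb
next-nothing X (i , j) () | just _  | nothing
next-nothing X (i , j) () | nothing | just _
next-nothing X (i , j) ns | just r  | just b with r <ᵇ b
next-nothing X (i , j) () | just r  | just b | true
next-nothing X (i , j) () | just r  | just b | false

slideAt-stop : ∀ f X s → Corner (cells X) s → slideAt f X s ≡ removeAt X s
slideAt-stop zero    X s       _         = refl
slideAt-stop (suc f) X (i , j) (Xr , Xb) rewrite Xr | Xb = refl

record Step (X : Tableau) (s t : Pos) : Set where
  field
    value     : ℕ
    occupied  : cells X t ≡ just value
    neighbour : Neighbour s t
    unfold    : ∀ f → slideAt (suc f) X s ≡ slideAt f (update X s value) t

next-step : ∀ X s {t} → next X s ≡ just t → Step X s t
next-step X (i , j) nt with get X i (suc j) in Xr | get X (suc i) j in Xb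
next-step X (i , j) refl | just r  | nothing = record { occupied = Xr ; neighbour = inj₁ refl ; unfold = unfold }
  where
  unfold : ∀ f → slide (suc f) X i j ≡ slide f (set X i j r) i (suc j)
  unfold f rewrite Xr | Xb = refl
next-step X (i , j) refl | nothing | just b  = record { occupied = Xb ; neighbour = inj₂ refl ; unfold = unfold }
  where
  unfold : ∀ f → slide (suc f) X i j ≡ slide f (set X i j b) (suc i) j
  unfold f rewrite Xr | Xb = refl
next-step X (i , j) nt   | just r  | just b with r <ᵇ b in r<b
next-step X (i , j) refl | just r  | just b | true  = record { occupied = Xr ; neighbour = inj₁ refl ; unfold = unfold }
  where
  unfold : ∀ f → slide (suc f) X i j ≡ slide f (set X i j r) i (suc j)
  unfold f rewrite Xr | Xb | r<b = refl
next-step X (i , j) refl | just r  | just b | false = record { occupied = Xb ; neighbour = inj₂ refl ; unfold = unfold }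
  where
  unfold : ∀ f → slide (suc f) X i j ≡ slide f (set X i j b) (suc i) j
  unfold f rewrite Xr | Xb | r<b = refl

-- The number of cells weakly south-east of s bounds the moves still to come, hence the fuel needed.
cellsFrom : Tableau → Pos → ℕ
cellsFrom []      _           = 0
cellsFrom (r ∷ X) (zero  , j) = (length r ∸ j) + cellsFrom X (zero , j)
cellsFrom (r ∷ X) (suc i , j) = cellsFrom X (i , j)

rowGet-length : ∀ r q {x} → rowGet r q ≡ just x → q < length r
rowGet-length (y ∷ r) zero    _  = s≤s z≤n
rowGet-length (y ∷ r) (suc q) rq = s≤s (rowGet-length r q rq)

cellsFrom-occupied : ∀ X t {v} → cells X t ≡ just v → 0 < cellsFrom X t
cellsFrom-occupied (r ∷ X) (zero  , j) rj = ≤-trans (m<n⇒0<n∸m (rowGet-length r j rj)) (m≤m+n _ _)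
cellsFrom-occupied (r ∷ X) (suc i , j) Xt = cellsFrom-occupied X (i , j) Xt

cellsFrom-right : ∀ X s {v} → cells X (right s) ≡ just v → cellsFrom X (right s) < cellsFrom X s
cellsFrom-right (r ∷ X) (zero  , j) rj =
  +-mono-<-≤ (∸-monoʳ-< (n<1+n j) (<⇒≤ (rowGet-length r (suc j) rj))) (column-mono X)
  where
  column-mono : ∀ X → cellsFrom X (zero , suc j) ≤ cellsFrom X (zero , j)
  column-mono []      = z≤n
  column-mono (r ∷ X) = +-mono-≤ (∸-monoʳ-≤ (length r) (n≤1+n j)) (column-mono X)
cellsFrom-right (r ∷ X) (suc i , j) Xr = cellsFrom-right X (i , j) Xr

cellsFrom-below : ∀ X s {w} → cells X s ≡ just w → cellsFrom X (below s) < cellsFrom X s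
cellsFrom-below (r ∷ X) (zero  , j) rj = +-monoˡ-≤ (cellsFrom X (zero , j)) (m<n⇒0<n∸m (rowGet-length r j rj))
cellsFrom-below (r ∷ X) (suc i , j) Xs = cellsFrom-below X (i , j) Xs

cellsFrom-step : ∀ X s {t w} → cells X s ≡ just w → Step X s t → cellsFrom X t < cellsFrom X s
cellsFrom-step X s Xs st with Step.neighbour st | Step.occupied st
... | inj₁ refl | Xt = cellsFrom-right X s Xt
... | inj₂ refl | _  = cellsFrom-below X s Xs

cellsFrom≤size : ∀ X s → cellsFrom X s ≤ size X
cellsFrom≤size []      _           = z≤n
cellsFrom≤size (r ∷ X) (zero  , j) = +-mono-≤ (m∸n≤m (length r) j) (cellsFrom≤size X (zero , j))
cellsFrom≤size (r ∷ X) (suc i , j) = ≤-trans (cellsFrom≤size X (i , j)) (m≤n+m _ _)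

cellsFrom-update : ∀ X s v t → cellsFrom (update X s v) t ≡ cellsFrom X t
cellsFrom-update X (i , j) v = go X i
  where
  go : ∀ X i t → cellsFrom (set X i j v) t ≡ cellsFrom X t
  go []      _       _           = refl
  go (r ∷ X) zero    (zero  , q) = cong (λ l → (l ∸ q) + cellsFrom X (zero , q)) (rowSet-length r j v)
  go (r ∷ X) zero    (suc p , q) = refl
  go (r ∷ X) (suc i) (zero  , q) = cong ((length r ∸ q) +_) (go X i (zero , q))
  go (r ∷ X) (suc i) (suc p , q) = go X i (p , q)

-- A move next to the maximum

_except_ : Maybe Pos → Pos → Maybe Pos
nothing except c = nothing
just t  except c with t ≟ₚ c
... | yes _ = nothing
... | no  _ = just t

except-self : ∀ c → just c except c ≡ nothing
except-self c with c ≟ₚ c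
... | yes _   = refl
... | no  c≢c = contradiction refl c≢c

except-other : ∀ {t c} → t ≢ c → just t except c ≡ just t
except-other {t} {c} t≢c with t ≟ₚ c
... | yes t≡c = contradiction t≡c t≢c
... | no  _   = refl

choose-right-max : ∀ s {N} mb → (∀ {b} → mb ≡ just b → b < N) →
  choose s (just N) mb except right s ≡ choose s nothing mb
choose-right-max s     nothing  _   = except-self (right s)
choose-right-max s {N} (just b) b<N with N <ᵇ b in N<ᵇb
... | true  = contradiction (<ᵇ⇒< N b (subst T (sym N<ᵇb) _)) (<-asym (b<N refl))
... | false = except-other (below≢right s)

choose-below-max : ∀ s {N} mr → (∀ {r} → mr ≡ just r → r < N) →
  choose s mr (just N) except below s ≡ choose s mr nothing
choose-below-max s     nothing  _   = except-self (below s)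
choose-below-max s {N} (just r) r<N with r <ᵇ N in r<ᵇN
... | true  = except-other (right≢below s)
... | false = contradiction (subst T r<ᵇN (<⇒<ᵇ (r<N refl))) λ ()

next-except : ∀ X s {c} → right s ≢ c → below s ≢ c → next X s except c ≡ next X s
next-except X s r≢c b≢c with next X s in ns
... | nothing = refl
... | just t with Step.neighbour (next-step X s ns)
...   | inj₁ refl = except-other r≢c
...   | inj₂ refl = except-other b≢c

-- Since the removed entry exceeds the other neighbours of s, its removal only cancels a move into its cell.
next-removeAt : ∀ {X c} s (ρ : Removable X c) →
  (∀ {y x} → Neighbour s y → y ≢ c → cells X y ≡ just x → x < Removable.entry ρ) →
  next (removeAt X c) s ≡ next X s except c
next-removeAt {X} {c} s ρ small with toSum (right s ≟ₚ c) | toSum (below s ≟ₚ c)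
... | inj₁ refl | _ = begin
  next (removeAt X c) s                                ≡⟨ cong₂ (choose s) (trans (cells-removeAt ρ _) (≔-same (cells X) c nothing))
                                                                           (removeAt-other ρ (below≢right s)) ⟩
  choose s nothing (cells X (below s))                 ≡⟨ choose-right-max s _ (small (inj₂ refl) (below≢right s)) ⟨
  choose s (just N) (cells X (below s)) except right s ≡⟨ cong (λ v → choose s v (cells X (below s)) except right s) occupied ⟨
  next X s except right s                              ∎
  where open Removable ρ renaming (entry to N)
... | inj₂ _ | inj₁ refl = begin
  next (removeAt X c) s                                ≡⟨ cong₂ (choose s) (removeAt-other ρ (right≢below s))
                                                                           (trans (cells-removeAt ρ _) (≔-same (cells X) c nothing)) ⟩
  choose s (cells X (right s)) nothing                 ≡⟨ choose-below-max s _ (small (inj₁ refl) (right≢below s)) ⟨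
  choose s (cells X (right s)) (just N) except below s ≡⟨ cong (λ v → choose s (cells X (right s)) v except below s) occupied ⟨
  next X s except below s                              ∎
  where open Removable ρ renaming (entry to N)
... | inj₂ r≢c | inj₂ b≢c = begin
  next (removeAt X c) s ≡⟨ cong₂ (choose s) (removeAt-other ρ r≢c) (removeAt-other ρ b≢c) ⟩
  next X s              ≡⟨ next-except X s r≢c b≢c ⟨
  next X s except c     ∎

-- Sliding past a maximal corner

record MaxCorner (N : ℕ) (P : ℕ → Set) (X : Tableau) (c : Pos) : Set where
  field
    nonEmpty : All NonEmpty X
    maxAt    : cells X c ≡ just N
    corner   : Corner (cells X) c
    others   : ∀ {y x} → cells X y ≡ just x → y ≢ c → P x

  removable : Removable X c
  removable = record { nonEmpty = nonEmpty ; occupied = maxAt ; corner = corner }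

-- A slide in progress: s is the space, which still holds a stale entry.
record Sliding (N : ℕ) (P : ℕ → Set) (X : Tableau) (c s : Pos) : Set where
  field
    nonEmpty  : All NonEmpty X
    maxAt     : cells X c ≡ just N
    corner    : Corner (cells X) c
    space     : ℕ
    spaceAt   : cells X s ≡ just space
    space≢max : s ≢ c
    others    : ∀ {y x} → cells X y ≡ just x → y ≢ c → y ≢ s → P x

  removable : Removable X c
  removable = record { nonEmpty = nonEmpty ; occupied = maxAt ; corner = corner }

module Simulation (N : ℕ) (P : ℕ → Set) (P⇒<N : ∀ {x} → P x → x < N) where

  WithoutMax : Tableau → Tableau → Set
  WithoutMax V S = Σ[ c ∈ Pos ] MaxCorner N P S c × V ≡ removeAt S c

  record Advance (X : Tableau) (c s t : Pos) : Set where
    field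
      value   : ℕ
      sliding : Sliding N P (update X s value) c t
      unfold  : ∀ f → slideAt (suc f) X s ≡ slideAt f (update X s value) t
      unfold′ : ∀ f → slideAt (suc f) (removeAt X c) s ≡ slideAt f (removeAt (update X s value) c) t
      nonzero : 0 < cellsFrom (removeAt (update X s value) c) t
      smaller : cellsFrom (removeAt (update X s value) c) t < cellsFrom (removeAt X c) s

  module _ {X c s} (σ : Sliding N P X c s) where
    open Sliding σ

    X′ : Tableau
    X′ = removeAt X c

    spaceAt′ : cells X′ s ≡ just space
    spaceAt′ = trans (removeAt-other removable space≢max) spaceAt

    next-X′ : next X′ s ≡ next X s except c
    next-X′ = next-removeAt s removable λ adj y≢c Xy → P⇒<N (others Xy y≢c (neighbour≢ adj))

    stop : next X s ≡ nothing → ∀ f → WithoutMax (slideAt f X′ s) (slideAt (suc f) X s)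
    stop ns f = subst₂ WithoutMax (sym (slideAt-stop f X′ s (removeAt-corner removable cs))) (sym (slideAt-stop (suc f) X s cs))
      (c , frame , removeAt-comm removable ρs (space≢max ∘ sym))
      where
      cs : Corner (cells X) s
      cs = next-nothing X s ns
      ρs : Removable X s
      ρs = record { nonEmpty = nonEmpty ; occupied = spaceAt ; corner = cs }
      frame : MaxCorner N P (removeAt X s) c
      frame = record
        { nonEmpty = removeAt-nonEmpty X s nonEmpty
        ; maxAt    = trans (removeAt-other ρs (space≢max ∘ sym)) maxAt
        ; corner   = removeAt-corner ρs corner
        ; others   = λ Sy y≢c → let y≢s , Xy = removeAt-just ρs Sy in others Xy y≢c y≢s
        }

    reachMax : next X s ≡ just c → ∀ f → WithoutMax (slideAt f X′ s) (slideAt (suc f) X s)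
    reachMax ns f = subst₂ WithoutMax (sym (slideAt-stop f X′ s cs′)) (sym slid) (s , frame , sym (removeAt-update N ρ′))
      where
      open Step (next-step X s ns)
      cs′ : Corner (cells X′) s
      cs′ = next-nothing X′ s (trans next-X′ (trans (cong (_except c) ns) (except-self c)))
      ρ′ : Removable X′ s
      ρ′ = record { nonEmpty = removeAt-nonEmpty X c nonEmpty ; occupied = spaceAt′ ; corner = cs′ }
      slid : slideAt (suc f) X s ≡ update X′ s N
      slid = begin
        slideAt (suc f) X s            ≡⟨ unfold f ⟩
        slideAt f (update X s value) c ≡⟨ cong (λ v → slideAt f (update X s v) c) (just-injective (trans (sym occupied) maxAt)) ⟩
        slideAt f (update X s N) c     ≡⟨ slideAt-stop f (update X s N) c (update-corner X s N spaceAt corner) ⟩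
        removeAt (update X s N) c      ≡⟨ update-removeAt-comm s N removable spaceAt space≢max ⟨
        update X′ s N                  ∎
      frame : MaxCorner N P (update X′ s N) s
      frame = record
        { nonEmpty = update-nonEmpty X′ s N (Removable.nonEmpty ρ′)
        ; maxAt    = update-same X′ s N spaceAt′
        ; corner   = update-corner X′ s N spaceAt′ cs′
        ; others   = others′
        }
        where
        others′ : ∀ {y x} → cells (update X′ s N) y ≡ just x → y ≢ s → P x
        others′ Sy y≢s with update-just X′ s N spaceAt′ Sy
        ... | inj₁ (y≡s , _) = contradiction y≡s y≢s
        ... | inj₂ (_ , X′y) = let y≢c , Xy = removeAt-just removable X′y in others Xy y≢c y≢s

    advance : ∀ {t} → next X s ≡ just t → t ≢ c → Advance X c s t
    advance {t} ns t≢c = record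
      { value   = value
      ; sliding = sliding
      ; unfold  = unfold
      ; unfold′ = λ f → trans (Step.unfold st′ f) (cong (λ Z → slideAt f Z t) (trans (cong (update X′ s) v′≡v) comm))
      ; nonzero = subst (0 <_) (sym measure) (cellsFrom-occupied X′ t X′t)
      ; smaller = subst (_< cellsFrom X′ s) (sym measure) (cellsFrom-step X′ s spaceAt′ st′)
      }
      where
      open Step (next-step X s ns)
      t≢s : t ≢ s
      t≢s = neighbour≢ neighbour
      X′t : cells X′ t ≡ just value
      X′t = trans (removeAt-other removable t≢c) occupied
      st′ : Step X′ s t
      st′ = next-step X′ s (trans next-X′ (trans (cong (_except c) ns) (except-other t≢c)))
      v′≡v : Step.value st′ ≡ value
      v′≡v = just-injective (trans (sym (Step.occupied st′)) X′t)
      comm : update X′ s value ≡ removeAt (update X s value) c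
      comm = update-removeAt-comm s value removable spaceAt space≢max
      measure : cellsFrom (removeAt (update X s value) c) t ≡ cellsFrom X′ t
      measure = trans (cong (λ Z → cellsFrom Z t) (sym comm)) (cellsFrom-update X′ s value t)
      sliding : Sliding N P (update X s value) c t
      sliding = record
        { nonEmpty  = update-nonEmpty X s value nonEmpty
        ; maxAt     = trans (update-other X s value spaceAt (space≢max ∘ sym)) maxAt
        ; corner    = update-corner X s value spaceAt corner
        ; spaceAt   = trans (update-other X s value spaceAt t≢s) occupied
        ; space≢max = t≢c
        ; others    = others′
        }
        where
        others′ : ∀ {y x} → cells (update X s value) y ≡ just x → y ≢ c → y ≢ t → P x
        others′ Yy y≢c y≢t with update-just X s value spaceAt Yy
        ... | inj₁ (_ , refl)  = others occupied t≢c t≢s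
        ... | inj₂ (y≢s , Xy) = others Xy y≢c y≢s

  slideAt-removeMax : ∀ f {X c s} → Sliding N P X c s → cellsFrom (removeAt X c) s ≤ suc f →
    WithoutMax (slideAt f (removeAt X c) s) (slideAt (suc f) X s)
  slideAt-removeMax f {X} {c} {s} σ bound with next X s in ns
  ... | nothing = stop σ ns f
  ... | just t with toSum (t ≟ₚ c)
  ...   | inj₁ refl = reachMax σ ns f
  slideAt-removeMax zero    σ bound | just t | inj₂ t≢c =
    contradiction (≤-trans smaller bound) (<⇒≱ (s≤s nonzero))
    where open Advance (advance σ ns t≢c)
  slideAt-removeMax (suc f) σ bound | just t | inj₂ t≢c =
    subst₂ WithoutMax (sym (unfold′ f)) (sym (unfold (suc f))) (slideAt-removeMax f sliding (≤-pred (≤-trans smaller bound)))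
    where open Advance (advance σ ns t≢c)

-- Deleting an entry

rowFind-sound : ∀ v r {q} → rowFind v r ≡ just q → rowGet r q ≡ just v
rowFind-sound v (x ∷ r) rf with x ≡ᵇ v in x≡ᵇv
rowFind-sound v (x ∷ r) refl | true  = cong just (≡ᵇ⇒≡ x v (subst T (sym x≡ᵇv) _))
rowFind-sound v (x ∷ r) rf   | false with rowFind v r in rf′
rowFind-sound v (x ∷ r) refl | false | just q = rowFind-sound v r rf′

rowFind-complete : ∀ v r {q} → rowGet r q ≡ just v → Σ[ q′ ∈ ℕ ] rowFind v r ≡ just q′
rowFind-complete v (x ∷ r) {q} rq with x ≡ᵇ v in x≡ᵇv
... | true = zero , refl
rowFind-complete v (x ∷ r) {zero}  refl | false = contradiction (subst T x≡ᵇv (≡⇒≡ᵇ x x refl)) λ ()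
rowFind-complete v (x ∷ r) {suc q} rq   | false with rowFind-complete v r rq
... | q′ , rf rewrite rf = suc q′ , refl

find-sound : ∀ v X {c} → find v X ≡ just c → cells X c ≡ just v
find-sound v (r ∷ X) fc with rowFind v r in rf
find-sound v (r ∷ X) refl | just q  = rowFind-sound v r rf
find-sound v (r ∷ X) fc   | nothing with find v X in fc′
find-sound v (r ∷ X) refl | nothing | just (p , q) = find-sound v X fc′

find-complete : ∀ v X {c} → cells X c ≡ just v → Σ[ c′ ∈ Pos ] find v X ≡ just c′
find-complete v (r ∷ X) {c} xc with rowFind v r in rf
... | just q = (zero , q) , refl
find-complete v (r ∷ X) {zero  , q} rq | nothing = contradiction (trans (sym (proj₂ (rowFind-complete v r rq))) rf) λ ()
find-complete v (r ∷ X) {suc p , q} xc | nothing with find-complete v X {p , q} xc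
... | (p′ , q′) , fc rewrite fc = (suc p′ , q′) , refl

find-unique : ∀ v X {c} → cells X c ≡ just v → (∀ {y} → cells X y ≡ just v → y ≡ c) → find v X ≡ just c
find-unique v X xc unique with find-complete v X xc
... | c′ , fc = trans fc (cong just (unique (find-sound v X fc)))

minus-found : ∀ X v c → find v X ≡ just c → X − v ≡ renumber v (slideAt (size X) X c)
minus-found X v (i , j) fc rewrite fc = refl

lower : ℕ → ℕ → ℕ
lower m p = if m <ᵇ p then p ∸ 1 else p

cells-renumber : ∀ m X → cells (renumber m X) ≗ Maybe.map (lower m) ∘ cells X
cells-renumber m []      _           = refl
cells-renumber m (r ∷ X) (zero  , q) = rowGet-map r q
  where
  rowGet-map : ∀ r q → rowGet (map (lower m) r) q ≡ Maybe.map (lower m) (rowGet r q)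
  rowGet-map []      _       = refl
  rowGet-map (x ∷ r) zero    = refl
  rowGet-map (x ∷ r) (suc q) = rowGet-map r q
cells-renumber m (r ∷ X) (suc p , q) = cells-renumber m X (p , q)

renumber-nonEmpty : ∀ m X → All NonEmpty X → All NonEmpty (renumber m X)
renumber-nonEmpty m []              []       = []
renumber-nonEmpty m ((x ∷ r) ∷ X)   (_ ∷ ne) = s≤s z≤n ∷ renumber-nonEmpty m X ne

renumber-removeAt : ∀ m X c → removeAt (renumber m X) c ≡ renumber m (removeAt X c)
renumber-removeAt m X (i , _) = go X i
  where
  dropLast-map : ∀ r → dropLast (map (lower m) r) ≡ map (lower m) (dropLast r)
  dropLast-map []          = refl
  dropLast-map (x ∷ [])    = refl
  dropLast-map (x ∷ y ∷ r) = cong (lower m x ∷_) (dropLast-map (y ∷ r))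
  go : ∀ X i → removeEnd (renumber m X) i ≡ renumber m (removeEnd X i)
  go []                _       = refl
  go ([] ∷ X)          zero    = refl
  go ((x ∷ []) ∷ X)    zero    = refl
  go ((x ∷ y ∷ r) ∷ X) zero    = cong (λ r′ → (lower m x ∷ r′) ∷ renumber m X) (dropLast-map (y ∷ r))
  go (r ∷ X)           (suc i) = cong (map (lower m) r ∷_) (go X i)

lower-≤ : ∀ m {x} → x ≤ m → lower m x ≡ x
lower-≤ m {x} x≤m with m <ᵇ x in m<ᵇx
... | true  = contradiction (<ᵇ⇒< m x (subst T (sym m<ᵇx) _)) (≤⇒≯ x≤m)
... | false = refl

lower-suc : ∀ {m} k → m ≤ k → lower m (suc k) ≡ k
lower-suc {m} k m≤k with m <ᵇ suc k in m<ᵇ1+k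
... | true  = refl
... | false = contradiction (subst T m<ᵇ1+k (<⇒<ᵇ (s≤s m≤k))) λ ()

lower-< : ∀ {m} k {x} → m ≤ k → x < suc k → x ≢ m → lower m x < k
lower-< {m} k {x} m≤k x<1+k x≢m with m <ᵇ x in m<ᵇx
lower-< {m} k {suc x} m≤k (s≤s x<k) x≢m | true  = x<k
lower-< {m} k {zero}  m≤k _         x≢m | true  = contradiction (<ᵇ⇒< m 0 (subst T (sym m<ᵇx) _)) λ ()
... | false = <-≤-trans (≤∧≢⇒< (≮⇒≥ (λ m<x → subst T m<ᵇx (<⇒<ᵇ m<x))) x≢m) m≤k

renumber-id : ∀ m X → (∀ {y x} → cells X y ≡ just x → x ≤ m) → renumber m X ≡ X
renumber-id m []      _     = refl
renumber-id m (r ∷ X) small = cong₂ _∷_ (row r (λ {q} → small {zero , q})) (renumber-id m X (λ {y} → small {below y}))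
  where
  row : ∀ r → (∀ {q x} → rowGet r q ≡ just x → x ≤ m) → map (lower m) r ≡ r
  row []      _     = refl
  row (x ∷ r) small = cong₂ _∷_ (lower-≤ m (small {zero} refl)) (row r (λ {q} → small {suc q}))

minus-max : ∀ {N X c} → MaxCorner N (_< N) X c → X − N ≡ removeAt X c
minus-max {N} {X} {c} μ = begin
  X − N                             ≡⟨ minus-found X N c (find-unique N X maxAt unique) ⟩
  renumber N (slideAt (size X) X c) ≡⟨ cong (renumber N) (slideAt-stop (size X) X c corner) ⟩
  renumber N (removeAt X c)         ≡⟨ renumber-id N _ small ⟩
  removeAt X c                      ∎
  where
  open MaxCorner μ
  unique : ∀ {y} → cells X y ≡ just N → y ≡ c
  unique {y} Xy with toSum (y ≟ₚ c)
  ... | inj₁ y≡c = y≡c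
  ... | inj₂ y≢c = contradiction (others Xy y≢c) (<-irrefl refl)
  small : ∀ {y x} → cells (removeAt X c) y ≡ just x → x ≤ N
  small X′y = let y≢c , Xy = removeAt-just removable X′y in <⇒≤ (others Xy y≢c)

map-just⁻¹ : ∀ (f : ℕ → ℕ) mx {y} → Maybe.map f mx ≡ just y → Σ[ x ∈ ℕ ] mx ≡ just x × f x ≡ y
map-just⁻¹ f (just x) refl = x , refl , refl

renumber-maxCorner : ∀ {k m S c} → m ≤ k → MaxCorner (suc k) (λ x → x < suc k × x ≢ m) S c →
  MaxCorner k (_< k) (renumber m S) c
renumber-maxCorner {k} {m} {S} {c} m≤k μ = record
  { nonEmpty = renumber-nonEmpty m S nonEmpty
  ; maxAt    = trans (cells-renumber m S c) (trans (cong (Maybe.map (lower m)) maxAt) (cong just (lower-suc k m≤k)))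
  ; corner   = Corner-resp (cells-renumber m S) (map-nothing (Corner.rightEmpty corner) , map-nothing (Corner.belowEmpty corner))
  ; others   = others′
  }
  where
  open MaxCorner μ
  others′ : ∀ {y x} → cells (renumber m S) y ≡ just x → y ≢ c → x < k
  others′ {y} Ry y≢c with map-just⁻¹ (lower m) (cells S y) (trans (sym (cells-renumber m S y)) Ry)
  ... | _ , Sy , refl = let x<1+k , x≢m = others Sy y≢c in lower-< k m≤k x<1+k x≢m

-- Standard Young tableaux

rowGet∈ : ∀ r q {x} → rowGet r q ≡ just x → x ∈ r
rowGet∈ (y ∷ r) zero    refl = here refl
rowGet∈ (y ∷ r) (suc q) rq   = there (rowGet∈ r q rq)

∈⇒rowGet : ∀ r {x} → x ∈ r → Σ[ q ∈ ℕ ] rowGet r q ≡ just x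
∈⇒rowGet (y ∷ r) (here refl) = zero , refl
∈⇒rowGet (y ∷ r) (there x∈r) = let q , rq = ∈⇒rowGet r x∈r in suc q , rq

cells∈ : ∀ X y {x} → cells X y ≡ just x → x ∈ concat X
cells∈ (r ∷ X) (zero  , q) rq = ∈-++⁺ˡ (rowGet∈ r q rq)
cells∈ (r ∷ X) (suc p , q) Xy = ∈-++⁺ʳ r (cells∈ X (p , q) Xy)

∈⇒cells : ∀ X {x} → x ∈ concat X → Σ[ y ∈ Pos ] cells X y ≡ just x
∈⇒cells (r ∷ X) x∈ with ∈-++⁻ r x∈
... | inj₁ x∈r = let q , rq = ∈⇒rowGet r x∈r in (zero , q) , rq
... | inj₂ x∈X = let y , Xy = ∈⇒cells X x∈X in below y , Xy

Unique-++⁻ : ∀ (xs : List ℕ) {ys} → Unique (xs ++ ys) → Unique xs × Unique ys × (∀ {x} → x ∈ xs → x ∉ ys)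
Unique-++⁻ []       u        = [] , u , λ ()
Unique-++⁻ (x ∷ xs) (x∉ ∷ u) with Unique-++⁻ xs u
... | uxs , uys , disjoint =
  All.++⁻ˡ xs x∉ ∷ uxs , uys , λ { (here refl) x∈ys → All.lookup (All.++⁻ʳ xs x∉) x∈ys refl ; (there x∈xs) → disjoint x∈xs }

rowGet-unique : ∀ r {q q′ x} → Unique r → rowGet r q ≡ just x → rowGet r q′ ≡ just x → q ≡ q′
rowGet-unique (y ∷ r) {zero}  {zero}   _        _    _    = refl
rowGet-unique (y ∷ r) {zero}  {suc q′} (y∉ ∷ _) refl rq′  = contradiction refl (All.lookup y∉ (rowGet∈ r q′ rq′))
rowGet-unique (y ∷ r) {suc q} {zero}   (y∉ ∷ _) rq   refl = contradiction refl (All.lookup y∉ (rowGet∈ r q rq))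
rowGet-unique (y ∷ r) {suc q} {suc q′} (_ ∷ u)  rq   rq′  = cong suc (rowGet-unique r u rq rq′)

cells-unique : ∀ X {y y′ x} → Unique (concat X) → cells X y ≡ just x → cells X y′ ≡ just x → y ≡ y′
cells-unique (r ∷ X) {zero  , q} {zero   , q′} u rq Xy′ = cong (zero ,_) (rowGet-unique r (proj₁ (Unique-++⁻ r u)) rq Xy′)
cells-unique (r ∷ X) {zero  , q} {suc p′ , q′} u rq Xy′ = contradiction (cells∈ X (p′ , q′) Xy′) (proj₂ (proj₂ (Unique-++⁻ r u)) (rowGet∈ r q rq))
cells-unique (r ∷ X) {suc p , q} {zero   , q′} u Xy rq′ = contradiction (cells∈ X (p , q) Xy) (proj₂ (proj₂ (Unique-++⁻ r u)) (rowGet∈ r q′ rq′))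
cells-unique (r ∷ X) {suc p , q} {suc p′ , q′} u Xy Xy′ = cong below (cells-unique X (proj₁ (proj₂ (Unique-++⁻ r u))) Xy Xy′)

rows-increasing : ∀ X s {x y} → All (Linked _<_) X → cells X s ≡ just x → cells X (right s) ≡ just y → x < y
rows-increasing (r ∷ X) (zero  , q) (inc ∷ _) = row r q inc
  where
  row : ∀ r q {x y} → Linked _<_ r → rowGet r q ≡ just x → rowGet r (suc q) ≡ just y → x < y
  row (a ∷ b ∷ r) zero    (a<b ∷ _) refl refl = a<b
  row (a ∷ b ∷ r) (suc q) (_ ∷ inc) ra   rb   = row (b ∷ r) q inc ra rb
rows-increasing (r ∷ X) (suc p , q) (_ ∷ inc) = rows-increasing X (p , q) inc

columns-increasing : ∀ X s {x y} → Linked ColInc X → cells X s ≡ just x → cells X (below s) ≡ just y → x < y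
columns-increasing (r ∷ [])    (zero  , q) _         _  ()
columns-increasing (r ∷ [])    (suc p , q) _         ()
columns-increasing (r ∷ s ∷ X) (zero  , q) (inc ∷ _) rq sq = inc q _ _ rq sq
columns-increasing (r ∷ s ∷ X) (suc p , q) (_ ∷ inc) = columns-increasing (s ∷ X) (p , q) inc

module _ {n T} (syt : IsSYT n T) where
  open IsSYT syt

  entry≤ : ∀ {y x} → cells T y ≡ just x → x ≤ n
  entry≤ {y} Ty with ∈-map⁻ suc (∈-resp-↭ entries (cells∈ T y Ty))
  ... | _ , k∈ , refl = ∈-upTo⁻ k∈

  entry-exists : ∀ {v} → 1 ≤ v → v ≤ n → Σ[ y ∈ Pos ] cells T y ≡ just v
  entry-exists {suc k} _ v≤n = ∈⇒cells T (∈-resp-↭ (↭-sym entries) (∈-map⁺ suc (∈-upTo⁺ v≤n)))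

  entry-unique : ∀ {y y′ x} → cells T y ≡ just x → cells T y′ ≡ just x → y ≡ y′
  entry-unique = cells-unique T (Unique-resp-↭ (↭⇒↭ₛ (↭-sym entries)) (Unique.map⁺ suc-injective (Unique.upTo⁺ n)))

  syt-maxCorner : 1 ≤ n → Σ[ c ∈ Pos ] MaxCorner n (_< n) T c
  syt-maxCorner 1≤n = c , record
    { nonEmpty = rowsNonEmpty
    ; maxAt    = Tc
    ; corner   = empty (rows-increasing T c rowsInc Tc) , empty (columns-increasing T c colsInc Tc)
    ; others   = λ Ty y≢c → ≤∧≢⇒< (entry≤ Ty) λ { refl → y≢c (entry-unique Ty Tc) }
    }
    where
    c = proj₁ (entry-exists 1≤n ≤-refl)
    Tc = proj₂ (entry-exists 1≤n ≤-refl)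
    empty : ∀ {p} → (∀ {y} → cells T p ≡ just y → n < y) → cells T p ≡ nothing
    empty {p} n<_ = vacant (cells T p) λ Tp → <⇒≱ (n<_ Tp) (entry≤ Tp)
      where
      vacant : ∀ (mx : Maybe ℕ) → (∀ {y} → mx ≡ just y → ⊥) → mx ≡ nothing
      vacant nothing  _   = refl
      vacant (just y) ¬mx = ⊥-elim (¬mx refl)

syt-sliding : ∀ {k m T c s} → IsSYT (suc k) T → MaxCorner (suc k) (_< suc k) T c → cells T s ≡ just m → m ≤ k →
  Sliding (suc k) (λ x → x < suc k × x ≢ m) T c s
syt-sliding {T = T} syt μ Ts m≤k = record
  { nonEmpty  = nonEmpty
  ; maxAt     = maxAt
  ; corner    = corner
  ; spaceAt   = Ts
  ; space≢max = λ { refl → <-irrefl (just-injective (trans (sym Ts) maxAt)) (s≤s m≤k) }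
  ; others    = λ Ty y≢c y≢s → others Ty y≢c , λ { refl → y≢s (entry-unique syt Ty Ts) }
  }
  where open MaxCorner μ

minus-comm : ∀ k m T → IsSYT (suc k) T → 1 ≤ m → m ≤ k → (T − suc k) − m ≡ (T − m) − k
minus-comm k m T syt 1≤m m≤k
  with c , μ ← syt-maxCorner syt (s≤s z≤n)
  with s , Ts ← entry-exists syt 1≤m (m≤n⇒m≤1+n m≤k)
  with c′ , μ′ , V≡ ← Simulation.slideAt-removeMax (suc k) (λ x → x < suc k × x ≢ m) proj₁ (size (removeAt T c))
                        (syt-sliding syt μ Ts m≤k) (≤-trans (cellsFrom≤size (removeAt T c) s) (n≤1+n _))
  = begin
  (T − suc k) − m                                  ≡⟨ cong (_− m) (minus-max μ) ⟩
  T′ − m                                           ≡⟨ minus-found T′ m s (find-unique m T′ T′s unique′) ⟩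
  renumber m (slideAt (size T′) T′ s)              ≡⟨ cong (renumber m) V≡ ⟩
  renumber m (removeAt S c′)                       ≡⟨ renumber-removeAt m S c′ ⟨
  removeAt (renumber m S) c′                       ≡⟨ minus-max (renumber-maxCorner m≤k μ′) ⟨
  renumber m S − k                                 ≡⟨ cong (_− k) T−m ⟨
  (T − m) − k                                      ∎
  where
  T′ : Tableau
  T′ = removeAt T c
  S : Tableau
  S = slideAt (suc (size T′)) T s
  T′s : cells T′ s ≡ just m
  T′s = trans (removeAt-other (MaxCorner.removable μ) (Sliding.space≢max (syt-sliding syt μ Ts m≤k))) Ts
  unique′ : ∀ {y} → cells T′ y ≡ just m → y ≡ s
  unique′ T′y = entry-unique syt (proj₂ (removeAt-just (MaxCorner.removable μ) T′y)) Ts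
  T−m : T − m ≡ renumber m S
  T−m = trans (minus-found T m s (find-unique m T Ts (λ Ty → entry-unique syt Ty Ts)))
              (cong (λ f → renumber m (slideAt f T s)) (size-removeAt T c (MaxCorner.maxAt μ)))

mainTheorem3 : (n : ℕ) → 2 ≤ n → (T : Tableau) → IsSYT n T →
    (U : Tableau) →
      (Σ ℕ (λ m → (1 ≤ m) × (m ≤ n ∸ 1) × (U ≡ (T − n) − m)))
      ⇔ (Σ ℕ (λ m → (1 ≤ m) × (m ≤ n) × (U ≡ (T − m) − (n ∸ 1))))
mainTheorem3 (suc k) (s≤s 1≤k) T syt U = mk⇔
  (λ (m , 1≤m , m≤k , U≡) → m , 1≤m , m≤n⇒m≤1+n m≤k , trans U≡ (minus-comm k m T syt 1≤m m≤k))
  λ (m , 1≤m , m≤1+k , U≡) → case m≤n⇒m<n∨m≡n m≤1+k of λ where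
    (inj₁ (s≤s m≤k)) → m , 1≤m , m≤k , trans U≡ (sym (minus-comm k m T syt 1≤m m≤k))
    (inj₂ refl)      → k , 1≤k , ≤-refl , U≡
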